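{- For integers $n\ge i\ge 0$, let $U_{n,i}$ be the number of G-Motzkin paths of length $n$ with exactly $i$ $\mathbf{u}$-steps. Then for every integer $n\ge 0$, \[ \sum_{i=0}^{n}(-2)^{i}U_{n,i}=(-1)^{n}. \]
   Context: A G-Motzkin path of length $n$ is a lattice path from $(0,0)$ to $(n,0)$ that never goes below the $x$-axis and consists of up steps $\mathbf{u}=(1,1)$, down steps $\mathbf{d}=(1,-1)$, horizontal steps $\mathbf{h}=(1,0)$ and vertical steps $\mathbf{v}=(0,-1)$. -}

module Defs where

open import Data.Nat using (ℕ; zero; suc; _+_; _*_; _≡ᵇ_)
open import Data.Integer as ℤ using (ℤ; +_; -[1+_])
open import Data.List using (List; []; _∷_; map; concatMap; length; filterᵇ; sum; upTo; foldr)
open import Data.Bool using (Bool; true; false; _∧_)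

-- Steps of a G-Motzkin path: u = (1,1), d = (1,-1), h = (1,0), v = (0,-1).
data Step : Set where
  u d h v : Step

xlen : Step → ℕ
xlen v = 0
xlen _ = 1

-- length of a path = x-coordinate of its endpoint
pathLength : List Step → ℕ
pathLength = foldr (λ s n → xlen s + n) 0

numU : List Step → ℕ
numU [] = 0
numU (u ∷ p) = suc (numU p)
numU (_ ∷ p) = numU p

validFrom : ℕ → List Step → Bool
validFrom zero [] = true
validFrom (suc k) [] = false
validFrom k (u ∷ p) = validFrom (suc k) p
validFrom k (h ∷ p) = validFrom k p
validFrom zero (d ∷ p) = false
validFrom (suc k) (d ∷ p) = validFrom k p
validFrom zero (v ∷ p) = false
validFrom (suc k) (v ∷ p) = validFrom k p

isGMotzkin : List Step → Bool
isGMotzkin = validFrom 0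

allWords : ℕ → List (List Step)
allWords zero = [] ∷ []
allWords (suc m) = concatMap (λ w → (u ∷ w) ∷ (d ∷ w) ∷ (h ∷ w) ∷ (v ∷ w) ∷ []) (allWords m)

wordsUpTo : ℕ → List (List Step)
wordsUpTo M = concatMap allWords (upTo (suc M))

-- A G-Motzkin path of length n has at most 2n steps (#v + #d = #u ≤ n,
-- and #u + #d + #h = n), so enumerating all step lists with at most 2n
-- steps lists every such path exactly once.
U : ℕ → ℕ → ℕ
U n i = length (filterᵇ (λ p → isGMotzkin p ∧ (pathLength p ≡ᵇ n) ∧ (numU p ≡ᵇ i))
                        (wordsUpTo (2 * n)))

sumTo : ℕ → (ℕ → ℤ) → ℤ
sumTo zero f = f 0
sumTo (suc n) f = sumTo n f ℤ.+ f (suc n)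

module Submission where

-- Give a path p starting at height k the weight (-2)^(#u p). The total weight
-- W(k, n) of the paths of length n from height k down to the axis satisfies,
-- by splitting off the first step,
--   W(0, 0) = 1,            W(0, n+1)   = -2 W(1, n) + W(0, n),
--   W(k+1, 0) = W(k, 0),    W(k+1, n+1) = -2 W(k+2, n) + W(k, n) + W(k+1, n) + W(k, n+1),
-- and W(k, n) = (-1)^n solves this system. The theorem is the case k = 0,
-- regrouped by the number of u-steps.

open import Defs
open import Data.Bool using (Bool; true; false; _∧_; if_then_else_; T)
open import Data.Bool.Properties using (∧-zeroʳ)
open import Data.Integer using (ℤ; +_; -[1+_]; _+_; _*_; _^_; 0ℤ; 1ℤ; -1ℤ)
open import Data.Integer.Properties
  using (+-identityˡ; +-identityʳ; +-assoc; *-zeroʳ; *-identityʳ; *-distribˡ-+;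
         +-commutativeSemigroup)
open import Algebra.Properties.CommutativeSemigroup +-commutativeSemigroup using (interchange)
open import Data.Integer.Tactic.RingSolver using (solve-∀)
open import Data.List using (List; []; _∷_; _++_; length; filterᵇ; concatMap; applyUpTo)
open import Data.Nat as ℕ using (ℕ; zero; suc; _≤_; _≡ᵇ_; z≤n; s≤s)
import Data.Nat.Properties as ℕ
import Data.Nat.Tactic.RingSolver as ℕ-Solver
open import Data.Sum using (inj₁; inj₂)
open import Function using (_∘_)
open import Relation.Nullary.Decidable using (dec-true; dec-false)
open import Relation.Binary.PropositionalEquality
  using (_≡_; refl; sym; trans; cong; cong₂; subst; module ≡-Reasoning)

open ≡-Reasoning

infix 6.5 _when_

_when_ : ℤ → Bool → ℤ
x when b = if b then x else 0ℤ

*-when : ∀ c x b → c * (x when b) ≡ (c * x) when b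
*-when c x false = *-zeroʳ c
*-when c x true  = refl

-2ℤ : ℤ
-2ℤ = -[1+ 1 ]

sumᴸ : {A : Set} → (A → ℤ) → List A → ℤ
sumᴸ f []       = 0ℤ
sumᴸ f (x ∷ xs) = f x + sumᴸ f xs

module _ {A : Set} where

  sumᴸ-cong : {f g : A → ℤ} → (∀ x → f x ≡ g x) → ∀ xs → sumᴸ f xs ≡ sumᴸ g xs
  sumᴸ-cong f≗g []       = refl
  sumᴸ-cong f≗g (x ∷ xs) = cong₂ _+_ (f≗g x) (sumᴸ-cong f≗g xs)

  sumᴸ-zero : {f : A → ℤ} → (∀ x → f x ≡ 0ℤ) → ∀ xs → sumᴸ f xs ≡ 0ℤ
  sumᴸ-zero f≗0 []       = refl
  sumᴸ-zero f≗0 (x ∷ xs) = cong₂ _+_ (f≗0 x) (sumᴸ-zero f≗0 xs)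

  sumᴸ-+ : (f g : A → ℤ) → ∀ xs → sumᴸ (λ x → f x + g x) xs ≡ sumᴸ f xs + sumᴸ g xs
  sumᴸ-+ f g []       = refl
  sumᴸ-+ f g (x ∷ xs) = begin
    f x + g x + sumᴸ (λ x → f x + g x) xs ≡⟨ cong (_+_ (f x + g x)) (sumᴸ-+ f g xs) ⟩
    f x + g x + (sumᴸ f xs + sumᴸ g xs)   ≡⟨ interchange (f x) (g x) (sumᴸ f xs) (sumᴸ g xs) ⟩
    f x + sumᴸ f xs + (g x + sumᴸ g xs)   ∎

  sumᴸ-*ˡ : (c : ℤ) (f : A → ℤ) → ∀ xs → sumᴸ (λ x → c * f x) xs ≡ c * sumᴸ f xs
  sumᴸ-*ˡ c f []       = sym (*-zeroʳ c)
  sumᴸ-*ˡ c f (x ∷ xs) =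
    trans (cong (_+_ (c * f x)) (sumᴸ-*ˡ c f xs)) (sym (*-distribˡ-+ c (f x) (sumᴸ f xs)))

  sumᴸ-++ : (f : A → ℤ) → ∀ xs ys → sumᴸ f (xs ++ ys) ≡ sumᴸ f xs + sumᴸ f ys
  sumᴸ-++ f []       ys = sym (+-identityˡ (sumᴸ f ys))
  sumᴸ-++ f (x ∷ xs) ys =
    trans (cong (_+_ (f x)) (sumᴸ-++ f xs ys)) (sym (+-assoc (f x) (sumᴸ f xs) (sumᴸ f ys)))

  sumᴸ-concatMap : {B : Set} (f : A → ℤ) (g : B → List A) →
                   ∀ ys → sumᴸ f (concatMap g ys) ≡ sumᴸ (sumᴸ f ∘ g) ys
  sumᴸ-concatMap f g []       = refl
  sumᴸ-concatMap f g (y ∷ ys) =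
    trans (sumᴸ-++ f (g y) (concatMap g ys)) (cong (_+_ (sumᴸ f (g y))) (sumᴸ-concatMap f g ys))

sumTo-cong : ∀ n {f g : ℕ → ℤ} → (∀ i → f i ≡ g i) → sumTo n f ≡ sumTo n g
sumTo-cong zero    f≗g = f≗g 0
sumTo-cong (suc n) f≗g = cong₂ _+_ (sumTo-cong n f≗g) (f≗g (suc n))

sumTo-zero : ∀ n {f : ℕ → ℤ} → (∀ i → i ≤ n → f i ≡ 0ℤ) → sumTo n f ≡ 0ℤ
sumTo-zero zero    f≗0 = f≗0 0 z≤n
sumTo-zero (suc n) f≗0 =
  cong₂ _+_ (sumTo-zero n (λ i i≤n → f≗0 i (ℕ.m≤n⇒m≤1+n i≤n))) (f≗0 (suc n) ℕ.≤-refl)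

sumTo-+ : ∀ n (f g : ℕ → ℤ) → sumTo n (λ i → f i + g i) ≡ sumTo n f + sumTo n g
sumTo-+ zero    f g = refl
sumTo-+ (suc n) f g = begin
  sumTo n (λ i → f i + g i) + (f (suc n) + g (suc n))
    ≡⟨ cong (_+ (f (suc n) + g (suc n))) (sumTo-+ n f g) ⟩
  sumTo n f + sumTo n g + (f (suc n) + g (suc n))
    ≡⟨ interchange (sumTo n f) (sumTo n g) (f (suc n)) (g (suc n)) ⟩
  sumTo n f + f (suc n) + (sumTo n g + g (suc n)) ∎

sumTo-δ : ∀ (g : ℕ → ℤ) {j} n → j ≤ n → sumTo n (λ i → g i when (j ≡ᵇ i)) ≡ g j
sumTo-δ g zero z≤n = refl
sumTo-δ g {j} (suc n) j≤1+n with ℕ.m≤n⇒m<n∨m≡n j≤1+n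
... | inj₁ j<1+n = begin
  sumTo n (λ i → g i when (j ≡ᵇ i)) + g (suc n) when (j ≡ᵇ suc n)
    ≡⟨ cong₂ _+_ (sumTo-δ g n (ℕ.≤-pred j<1+n))
                 (cong (g (suc n) when_) (dec-false (j ℕ.≟ suc n) (ℕ.<⇒≢ j<1+n))) ⟩
  g j + 0ℤ
    ≡⟨ +-identityʳ (g j) ⟩
  g j ∎
... | inj₂ refl = begin
  sumTo n (λ i → g i when (suc n ≡ᵇ i)) + g (suc n) when (n ≡ᵇ n)
    ≡⟨ cong₂ _+_ (sumTo-zero n (λ i i≤n → cong (g i when_)
                                 (dec-false (suc n ℕ.≟ i) (ℕ.>⇒≢ (s≤s i≤n)))))
                 (cong (g (suc n) when_) (dec-true (n ℕ.≟ n) refl)) ⟩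
  0ℤ + g (suc n)
    ≡⟨ +-identityˡ (g (suc n)) ⟩
  g (suc n) ∎

length-filterᵇ-∷ : {A : Set} (P : A → Bool) → ∀ x xs →
                   + length (filterᵇ P (x ∷ xs)) ≡ 1ℤ when P x + + length (filterᵇ P xs)
length-filterᵇ-∷ P x xs with P x
... | true  = refl
... | false = sym (+-identityˡ _)

sumTo-count : ∀ n (g : ℕ → ℤ) {A : Set} (Q : ℕ → A → Bool) (c : A → ℤ) →
              (∀ x → sumTo n (λ i → g i when Q i x) ≡ c x) →
              ∀ xs → sumTo n (λ i → g i * + length (filterᵇ (Q i) xs)) ≡ sumᴸ c xs
sumTo-count n g Q c sum≡c [] = sumTo-zero n (λ i _ → *-zeroʳ (g i))
sumTo-count n g Q c sum≡c (x ∷ xs) = begin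
  sumTo n (λ i → g i * + length (filterᵇ (Q i) (x ∷ xs)))
    ≡⟨ sumTo-cong n split ⟩
  sumTo n (λ i → g i when Q i x + g i * + length (filterᵇ (Q i) xs))
    ≡⟨ sumTo-+ n _ _ ⟩
  sumTo n (λ i → g i when Q i x) + sumTo n (λ i → g i * + length (filterᵇ (Q i) xs))
    ≡⟨ cong₂ _+_ (sum≡c x) (sumTo-count n g Q c sum≡c xs) ⟩
  c x + sumᴸ c xs ∎
  where
  split : ∀ i → g i * + length (filterᵇ (Q i) (x ∷ xs))
              ≡ g i when Q i x + g i * + length (filterᵇ (Q i) xs)
  split i = begin
    g i * + length (filterᵇ (Q i) (x ∷ xs))
      ≡⟨ cong (g i *_) (length-filterᵇ-∷ (Q i) x xs) ⟩
    g i * (1ℤ when Q i x + + length (filterᵇ (Q i) xs))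
      ≡⟨ *-distribˡ-+ (g i) _ _ ⟩
    g i * (1ℤ when Q i x) + g i * + length (filterᵇ (Q i) xs)
      ≡⟨ cong (_+ g i * + length (filterᵇ (Q i) xs))
              (trans (*-when (g i) 1ℤ (Q i x)) (cong (_when Q i x) (*-identityʳ (g i)))) ⟩
    g i when Q i x + g i * + length (filterᵇ (Q i) xs) ∎

weight : ℕ → ℕ → List Step → ℤ
weight k n p = -2ℤ ^ numU p when ((pathLength p ≡ᵇ n) ∧ validFrom k p)

-- validFrom inspects the height before the first step, hence the split on k.
weight-u : ∀ k n p → weight k (suc n) (u ∷ p) ≡ -2ℤ * weight (suc k) n p
weight-u zero    n p = sym (*-when -2ℤ (-2ℤ ^ numU p) ((pathLength p ≡ᵇ n) ∧ validFrom 1 p))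
weight-u (suc k) n p = sym (*-when -2ℤ (-2ℤ ^ numU p) ((pathLength p ≡ᵇ n) ∧ validFrom (2 ℕ.+ k) p))

weight-ground : ∀ n s p → validFrom 0 (s ∷ p) ≡ false → weight 0 n (s ∷ p) ≡ 0ℤ
weight-ground n s p invalid =
  cong (-2ℤ ^ numU (s ∷ p) when_) (trans (cong (_∧_ (pathLength (s ∷ p) ≡ᵇ n)) invalid) (∧-zeroʳ _))

extensions : List Step → List (List Step)
extensions p = (u ∷ p) ∷ (d ∷ p) ∷ (h ∷ p) ∷ (v ∷ p) ∷ []

weight-extensions-0-0 : ∀ p → sumᴸ (weight 0 0) (extensions p) ≡ 0ℤ
weight-extensions-0-0 p = cong (λ x → 0ℤ + (0ℤ + (0ℤ + (x + 0ℤ)))) (weight-ground 0 v p refl)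

weight-extensions-0-suc : ∀ n p →
  sumᴸ (weight 0 (suc n)) (extensions p) ≡ -2ℤ * weight 1 n p + weight 0 n p
weight-extensions-0-suc n p = cong₂ _+_ (weight-u 0 n p) (begin
  weight 0 (suc n) (d ∷ p) + (weight 0 n p + (weight 0 (suc n) (v ∷ p) + 0ℤ))
    ≡⟨ cong₂ (λ x y → x + (weight 0 n p + (y + 0ℤ)))
             (weight-ground (suc n) d p refl) (weight-ground (suc n) v p refl) ⟩
  0ℤ + (weight 0 n p + 0ℤ)
    ≡⟨ +-identityˡ _ ⟩
  weight 0 n p + 0ℤ
    ≡⟨ +-identityʳ _ ⟩
  weight 0 n p ∎)

weight-extensions-suc-0 : ∀ k p → sumᴸ (weight (suc k) 0) (extensions p) ≡ weight k 0 p
weight-extensions-suc-0 k p =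
  trans (+-identityˡ _) (trans (+-identityˡ _) (trans (+-identityˡ _) (+-identityʳ (weight k 0 p))))

weight-extensions-suc-suc : ∀ k n p →
  sumᴸ (weight (suc k) (suc n)) (extensions p)
    ≡ -2ℤ * weight (suc (suc k)) n p + (weight k n p + (weight (suc k) n p + weight k (suc n) p))
weight-extensions-suc-suc k n p =
  cong₂ _+_ (weight-u (suc k) n p)
            (cong (λ x → weight k n p + (weight (suc k) n p + x)) (+-identityʳ (weight k (suc n) p)))

sumᴸ-allWords-suc : (f : List Step → ℤ) (g : ℕ → ℕ) → ∀ N →
  sumᴸ f (concatMap allWords (applyUpTo (suc ∘ g) N))
    ≡ sumᴸ (sumᴸ f ∘ extensions) (concatMap allWords (applyUpTo g N))
sumᴸ-allWords-suc f g zero    = refl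
sumᴸ-allWords-suc f g (suc N) = begin
  sumᴸ f (allWords (suc (g 0)) ++ concatMap allWords (applyUpTo (suc ∘ g ∘ suc) N))
    ≡⟨ sumᴸ-++ f (allWords (suc (g 0))) _ ⟩
  sumᴸ f (allWords (suc (g 0))) + sumᴸ f (concatMap allWords (applyUpTo (suc ∘ g ∘ suc) N))
    ≡⟨ cong₂ _+_ (sumᴸ-concatMap f extensions (allWords (g 0))) (sumᴸ-allWords-suc f (g ∘ suc) N) ⟩
  sumᴸ (sumᴸ f ∘ extensions) (allWords (g 0))
    + sumᴸ (sumᴸ f ∘ extensions) (concatMap allWords (applyUpTo (g ∘ suc) N))
    ≡⟨ sym (sumᴸ-++ (sumᴸ f ∘ extensions) (allWords (g 0)) _) ⟩
  sumᴸ (sumᴸ f ∘ extensions) (concatMap allWords (applyUpTo g (suc N))) ∎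

sumᴸ-wordsUpTo-suc : (f : List Step → ℤ) → ∀ M →
  sumᴸ f (wordsUpTo (suc M)) ≡ f [] + sumᴸ (sumᴸ f ∘ extensions) (wordsUpTo M)
sumᴸ-wordsUpTo-suc f M = cong (_+_ (f [])) (sumᴸ-allWords-suc f (λ m → m) (suc M))

weightUpTo : ℕ → ℕ → ℕ → ℤ
weightUpTo M k n = sumᴸ (weight k n) (wordsUpTo M)

weightUpTo-0-0 : ∀ M → weightUpTo M 0 0 ≡ 1ℤ
weightUpTo-0-0 zero    = refl
weightUpTo-0-0 (suc M) =
  trans (sumᴸ-wordsUpTo-suc (weight 0 0) M)
        (cong (_+_ 1ℤ) (sumᴸ-zero weight-extensions-0-0 (wordsUpTo M)))

weightUpTo-0-suc : ∀ M n →
  weightUpTo (suc M) 0 (suc n) ≡ -2ℤ * weightUpTo M 1 n + weightUpTo M 0 n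
weightUpTo-0-suc M n = begin
  weightUpTo (suc M) 0 (suc n)
    ≡⟨ sumᴸ-wordsUpTo-suc (weight 0 (suc n)) M ⟩
  0ℤ + sumᴸ (sumᴸ (weight 0 (suc n)) ∘ extensions) W
    ≡⟨ +-identityˡ _ ⟩
  sumᴸ (sumᴸ (weight 0 (suc n)) ∘ extensions) W
    ≡⟨ sumᴸ-cong (weight-extensions-0-suc n) W ⟩
  sumᴸ (λ p → -2ℤ * weight 1 n p + weight 0 n p) W
    ≡⟨ sumᴸ-+ (λ p → -2ℤ * weight 1 n p) (weight 0 n) W ⟩
  sumᴸ (λ p → -2ℤ * weight 1 n p) W + weightUpTo M 0 n
    ≡⟨ cong (_+ weightUpTo M 0 n) (sumᴸ-*ˡ -2ℤ (weight 1 n) W) ⟩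
  -2ℤ * weightUpTo M 1 n + weightUpTo M 0 n ∎
  where W = wordsUpTo M

weightUpTo-suc-0 : ∀ M k → weightUpTo (suc M) (suc k) 0 ≡ weightUpTo M k 0
weightUpTo-suc-0 M k = begin
  weightUpTo (suc M) (suc k) 0
    ≡⟨ sumᴸ-wordsUpTo-suc (weight (suc k) 0) M ⟩
  0ℤ + sumᴸ (sumᴸ (weight (suc k) 0) ∘ extensions) (wordsUpTo M)
    ≡⟨ +-identityˡ _ ⟩
  sumᴸ (sumᴸ (weight (suc k) 0) ∘ extensions) (wordsUpTo M)
    ≡⟨ sumᴸ-cong (weight-extensions-suc-0 k) (wordsUpTo M) ⟩
  weightUpTo M k 0 ∎

weightUpTo-suc-suc : ∀ M k n →
  weightUpTo (suc M) (suc k) (suc n)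
    ≡ -2ℤ * weightUpTo M (suc (suc k)) n
      + (weightUpTo M k n + (weightUpTo M (suc k) n + weightUpTo M k (suc n)))
weightUpTo-suc-suc M k n = begin
  weightUpTo (suc M) (suc k) (suc n)
    ≡⟨ sumᴸ-wordsUpTo-suc (weight (suc k) (suc n)) M ⟩
  0ℤ + sumᴸ (sumᴸ (weight (suc k) (suc n)) ∘ extensions) W
    ≡⟨ +-identityˡ _ ⟩
  sumᴸ (sumᴸ (weight (suc k) (suc n)) ∘ extensions) W
    ≡⟨ sumᴸ-cong (weight-extensions-suc-suc k n) W ⟩
  sumᴸ (λ p → -2ℤ * weight (suc (suc k)) n p
              + (weight k n p + (weight (suc k) n p + weight k (suc n) p))) W
    ≡⟨ sumᴸ-+ (λ p → -2ℤ * weight (suc (suc k)) n p) _ W ⟩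
  sumᴸ (λ p → -2ℤ * weight (suc (suc k)) n p) W
    + sumᴸ (λ p → weight k n p + (weight (suc k) n p + weight k (suc n) p)) W
    ≡⟨ cong₂ _+_ (sumᴸ-*ˡ -2ℤ (weight (suc (suc k)) n) W)
                 (trans (sumᴸ-+ (weight k n) _ W)
                        (cong (_+_ (weightUpTo M k n)) (sumᴸ-+ (weight (suc k) n) (weight k (suc n)) W))) ⟩
  -2ℤ * weightUpTo M (suc (suc k)) n
    + (weightUpTo M k n + (weightUpTo M (suc k) n + weightUpTo M k (suc n))) ∎
  where W = wordsUpTo M

-- A path of length n from height k has at most maxSteps k n steps (#v + #d ≤ k + #u),
-- so for maxSteps k n ≤ M the truncated enumeration wordsUpTo M misses none of them.
maxSteps : ℕ → ℕ → ℕ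
maxSteps k n = 2 ℕ.* n ℕ.+ k

maxSteps-sucʳ-≤ : ∀ k n {M} → maxSteps k (suc n) ≤ suc M → maxSteps (suc k) n ≤ M
maxSteps-sucʳ-≤ k n {M} le = ℕ.≤-pred (subst (_≤ suc M) (maxSteps-sucʳ k n) le)
  where
  maxSteps-sucʳ : ∀ k n → 2 ℕ.* suc n ℕ.+ k ≡ suc (2 ℕ.* n ℕ.+ suc k)
  maxSteps-sucʳ = ℕ-Solver.solve-∀

maxSteps-sucˡ-≤ : ∀ k n {M} → maxSteps (suc k) n ≤ suc M → maxSteps k n ≤ M
maxSteps-sucˡ-≤ k n {M} le = ℕ.≤-pred (subst (_≤ suc M) (ℕ.+-suc (2 ℕ.* n) k) le)

maxSteps-predˡ : ∀ k n {M} → maxSteps (suc k) n ≤ M → maxSteps k n ≤ M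
maxSteps-predˡ k n = ℕ.≤-trans (ℕ.+-monoʳ-≤ (2 ℕ.* n) (ℕ.n≤1+n k))

weightUpTo-closedForm : ∀ M k n → maxSteps k n ≤ M → weightUpTo M k n ≡ -1ℤ ^ n
weightUpTo-closedForm M       zero    zero    _  = weightUpTo-0-0 M
weightUpTo-closedForm zero    zero    (suc n) ()
weightUpTo-closedForm zero    (suc k) zero    ()
weightUpTo-closedForm zero    (suc k) (suc n) ()
weightUpTo-closedForm (suc M) zero    (suc n) le = begin
  weightUpTo (suc M) 0 (suc n)
    ≡⟨ weightUpTo-0-suc M n ⟩
  -2ℤ * weightUpTo M 1 n + weightUpTo M 0 n
    ≡⟨ cong₂ (λ x y → -2ℤ * x + y) (weightUpTo-closedForm M 1 n le′)
                                   (weightUpTo-closedForm M 0 n (maxSteps-predˡ 0 n le′)) ⟩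
  -2ℤ * -1ℤ ^ n + -1ℤ ^ n
    ≡⟨ collect (-1ℤ ^ n) ⟩
  -1ℤ ^ suc n ∎
  where
  le′ = maxSteps-sucʳ-≤ 0 n le
  collect : ∀ x → -2ℤ * x + x ≡ -1ℤ * x
  collect = solve-∀
weightUpTo-closedForm (suc M) (suc k) zero    le =
  trans (weightUpTo-suc-0 M k) (weightUpTo-closedForm M k 0 (ℕ.≤-pred le))
weightUpTo-closedForm (suc M) (suc k) (suc n) le = begin
  weightUpTo (suc M) (suc k) (suc n)
    ≡⟨ weightUpTo-suc-suc M k n ⟩
  -2ℤ * weightUpTo M (suc (suc k)) n
    + (weightUpTo M k n + (weightUpTo M (suc k) n + weightUpTo M k (suc n)))
    ≡⟨ cong₂ (λ x y → -2ℤ * x + y) (weightUpTo-closedForm M (suc (suc k)) n le′)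
         (cong₂ _+_ (weightUpTo-closedForm M k n (maxSteps-predˡ k n le″))
           (cong₂ _+_ (weightUpTo-closedForm M (suc k) n le″)
                      (weightUpTo-closedForm M k (suc n) (maxSteps-sucˡ-≤ k (suc n) le)))) ⟩
  -2ℤ * -1ℤ ^ n + (-1ℤ ^ n + (-1ℤ ^ n + -1ℤ * -1ℤ ^ n))
    ≡⟨ collect (-1ℤ ^ n) ⟩
  -1ℤ ^ suc n ∎
  where
  le′ = maxSteps-sucʳ-≤ (suc k) n le
  le″ = maxSteps-predˡ (suc k) n le′
  collect : ∀ x → -2ℤ * x + (x + (x + -1ℤ * x)) ≡ -1ℤ * x
  collect = solve-∀

numU≤pathLength : ∀ p → numU p ≤ pathLength p
numU≤pathLength []      = z≤n
numU≤pathLength (u ∷ p) = s≤s (numU≤pathLength p)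
numU≤pathLength (d ∷ p) = ℕ.m≤n⇒m≤1+n (numU≤pathLength p)
numU≤pathLength (h ∷ p) = ℕ.m≤n⇒m≤1+n (numU≤pathLength p)
numU≤pathLength (v ∷ p) = numU≤pathLength p

sumTo-indicator≡weight : ∀ n p →
  sumTo n (λ i → -2ℤ ^ i when (isGMotzkin p ∧ (pathLength p ≡ᵇ n) ∧ (numU p ≡ᵇ i)))
    ≡ -2ℤ ^ numU p when ((pathLength p ≡ᵇ n) ∧ isGMotzkin p)
sumTo-indicator≡weight n p with isGMotzkin p | pathLength p ≡ᵇ n in length≡n
... | false | false = sumTo-zero n (λ _ _ → refl)
... | false | true  = sumTo-zero n (λ _ _ → refl)
... | true  | false = sumTo-zero n (λ _ _ → refl)
... | true  | true  = sumTo-δ (-2ℤ ^_) n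
  (ℕ.≤-trans (numU≤pathLength p) (ℕ.≤-reflexive (ℕ.≡ᵇ⇒≡ _ n (subst T (sym length≡n) _))))

theorem2p13 : (n : ℕ) → sumTo n (λ i → (-[1+ 1 ] ^ i) * (+ U n i)) ≡ (-[1+ 0 ] ^ n)
theorem2p13 n = begin
  sumTo n (λ i → -2ℤ ^ i * + U n i)
    ≡⟨ sumTo-count n (-2ℤ ^_) (λ i p → isGMotzkin p ∧ (pathLength p ≡ᵇ n) ∧ (numU p ≡ᵇ i))
                   (weight 0 n) (sumTo-indicator≡weight n) (wordsUpTo (2 ℕ.* n)) ⟩
  weightUpTo (2 ℕ.* n) 0 n
    ≡⟨ weightUpTo-closedForm (2 ℕ.* n) 0 n (ℕ.≤-reflexive (ℕ.+-identityʳ (2 ℕ.* n))) ⟩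
  -1ℤ ^ n ∎
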